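{- For $(n_1,\dots,n_r)\in\mathbb C^r$ define $$\Phi(n_1,\dots,n_r)=\sum_{k=1}^{r-1}(n_k+n_{k+1})\frac{(n_1+\dots+n_k)(n_{k+1}+\dots+n_r)}{2}.$$ Then $\Phi$ is invariant under permutations: $\Phi(n_1,\dots,n_r)=\Phi(n_{\sigma(1)},\dots,n_{\sigma(r)})$ for every $\sigma\in S_r$. In particular, for a partition $P$ of a positive integer $n$ into positive integers $n=n_1+\dots+n_r$, $\Phi(P):=\Phi(n_1,\dots,n_r)$ is well defined, and among all partitions $P$ of $n$ with $r\ge2$ parts, $$\Phi(P)\ge\Phi(n-1,1)=\Phi(1,n-1)=\frac{n(n-1)}{2}.$$ -}

module Defs where

open import Level using (Level)
open import Algebra.Bundles using (CommutativeRing)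
open import Data.Nat using (ℕ)
open import Data.Integer using (+_)
open import Data.List using (List; []; _∷_)
open import Data.Rational using (ℚ; _/_)
open import Data.Rational.Properties using (+-*-commutativeRing)

module _ {c ℓ : Level} (R : CommutativeRing c ℓ) where
  open CommutativeRing R

  sumR : List Carrier → Carrier
  sumR []       = 0#
  sumR (x ∷ xs) = x + sumR xs

  -- ΦAcc h p (n_k ∷ n_{k+1} ∷ …) : p is the prefix sum n_1+…+n_{k-1},
  -- h plays the role of 1/2.  Term k is (n_k+n_{k+1})(n_1+…+n_k)(n_{k+1}+…+n_r)/2.
  ΦAcc : Carrier → Carrier → List Carrier → Carrier
  ΦAcc h p []           = 0#
  ΦAcc h p (x ∷ [])     = 0#
  ΦAcc h p (x ∷ y ∷ zs) =
    h * ((x + y) * ((p + x) * sumR (y ∷ zs))) + ΦAcc h (p + x) (y ∷ zs)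

  Φ : Carrier → List Carrier → Carrier
  Φ h = ΦAcc h 0#

ℕ→ℚ : ℕ → ℚ
ℕ→ℚ k = + k / 1

Φℚ : List ℚ → ℚ
Φℚ = Φ +-*-commutativeRing Data.Rational.½

-- Writing Tᵢ = nᵢ + ⋯ + n_r for the suffix sums, the prefix sums in Φ telescope away and
-- 2Φ(n₁,…,n_r) = Σᵢ nᵢ Tᵢ Tᵢ₊₁.  This expression depends on n₂,…,n_r only through T₂ and its
-- own value on them, and a short computation shows that it is unchanged when n₁ and n₂ are
-- swapped; hence it is invariant under every permutation.  For positive integers with
-- T₁ = n and r ≥ 2, induction on r gives 2Φ ≥ n² − n = 2Φ(n − 1, 1), the only input being
-- a + b ≤ ab + 1, i.e. (a − 1)(b − 1) ≥ 0, for positive a and b.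
module Submission where

open import Defs
open import Level using (Level)
open import Algebra.Bundles using (CommutativeSemiring; CommutativeRing)
open import Data.Nat using (ℕ; zero; suc; _≤_; _∸_; z≤n; s≤s; >-nonZero)
import Data.Nat as ℕ
import Data.Nat.Properties as ℕ
open import Data.Nat.Tactic.RingSolver using (solve-∀)
open import Data.Nat.ListAction using (sum)
open import Data.Integer using (+_)
import Data.Integer as ℤ
import Data.Integer.Properties as ℤ
open import Data.Nat.Coprimality using (1-coprimeTo) renaming (sym to coprime-sym)
open import Data.Fin using (Fin; zero; suc; punchIn)
open import Data.Fin.Properties using (punchIn-punchOut)
open import Data.Fin.Permutation using (Permutation′; _⟨$⟩ʳ_; remove)
open import Data.List using (List; []; _∷_; length; map; tabulate; foldr)
open import Data.List.Properties using (tabulate-cong; map-cong)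
open import Data.List.Relation.Binary.Permutation.Propositional as ↭
  using (_↭_; ↭-refl; ↭-prep; ↭-swap; ↭-trans; ↭-reflexive; ↭⇒↭ₛ′)
open import Data.List.Relation.Unary.All using (All; []; _∷_)
open import Data.Product using (_×_; _,_)
open import Data.Rational using (ℚ; ½; 1ℚ; mkℚ; *≤*) renaming (_≤_ to _≤ℚ_; _*_ to _*ℚ_; _+_ to _+ℚ_)
import Data.Rational.Properties as ℚ
open import Function using (_∘_)
open import Relation.Binary.PropositionalEquality as ≡ using (_≡_; cong)

module _ {a} {A : Set a} where

  tabulate-punchIn-↭ : ∀ {r} (x : Fin (suc r) → A) (k : Fin (suc r)) →
                       tabulate x ↭ x k ∷ tabulate (x ∘ punchIn k)
  tabulate-punchIn-↭ x zero = ↭-refl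
  tabulate-punchIn-↭ {suc r} x (suc k) =
    ↭-trans (↭-prep (x zero) (tabulate-punchIn-↭ (x ∘ suc) k)) (↭-swap (x zero) (x (suc k)) ↭-refl)

  tabulate-↭ : ∀ {r} (x : Fin r → A) (σ : Permutation′ r) → tabulate x ↭ tabulate (x ∘ (σ ⟨$⟩ʳ_))
  tabulate-↭ {zero}  x σ = ↭-refl
  tabulate-↭ {suc r} x σ =
    ↭-trans (tabulate-punchIn-↭ x k)
            (↭-prep (x k) (↭-trans (tabulate-↭ (x ∘ punchIn k) (remove zero σ))
                                   (↭-reflexive (tabulate-cong λ _ → cong x (punchIn-punchOut _)))))
    where k = σ ⟨$⟩ʳ zero

module SuffixSums {c ℓ} (R : CommutativeSemiring c ℓ) where
  open CommutativeSemiring R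
  open import Algebra.Solver.Ring.NaturalCoefficients.Default R
  open import Data.List.Relation.Binary.Permutation.Setoid.Properties setoid using (foldr-commMonoid)

  Σ : List Carrier → Carrier
  Σ = foldr _+_ 0#

  Ψ : List Carrier → Carrier
  Ψ []       = 0#
  Ψ (x ∷ xs) = x * Σ xs * Σ (x ∷ xs) + Ψ xs

  Σ-↭ : ∀ {xs ys} → xs ↭ ys → Σ xs ≈ Σ ys
  Σ-↭ p = foldr-commMonoid +-isCommutativeMonoid (↭⇒↭ₛ′ isEquivalence p)

  Ψ-swap : ∀ x y zs → Ψ (x ∷ y ∷ zs) ≈ Ψ (y ∷ x ∷ zs)
  Ψ-swap x y zs = solve 4
    (λ x y s t → x :* (y :+ s) :* (x :+ (y :+ s)) :+ (y :* s :* (y :+ s) :+ t)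
              := y :* (x :+ s) :* (y :+ (x :+ s)) :+ (x :* s :* (x :+ s) :+ t))
    refl x y (Σ zs) (Ψ zs)

  Ψ-∷-cong : ∀ x {xs ys} → xs ↭ ys → Ψ xs ≈ Ψ ys → Ψ (x ∷ xs) ≈ Ψ (x ∷ ys)
  Ψ-∷-cong x p Ψ≈ = +-cong (*-cong (*-congˡ (Σ-↭ p)) (+-congˡ (Σ-↭ p))) Ψ≈

  Ψ-↭ : ∀ {xs ys} → xs ↭ ys → Ψ xs ≈ Ψ ys
  Ψ-↭ ↭.refl              = refl
  Ψ-↭ (↭.prep x p)        = Ψ-∷-cong x p (Ψ-↭ p)
  Ψ-↭ (↭.swap {xs} x y p) = trans (Ψ-swap x y xs) (Ψ-∷-cong y (↭-prep x p) (Ψ-∷-cong x p (Ψ-↭ p)))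
  Ψ-↭ (↭.trans p q)       = trans (Ψ-↭ p) (Ψ-↭ q)

open SuffixSums ℕ.+-*-commutativeSemiring using () renaming (Ψ to Ψℕ)

module _ {c ℓ} (R : CommutativeSemiring c ℓ) where
  open CommutativeSemiring R
  open SuffixSums R
  open import Algebra.Properties.Semiring.Mult semiring using (×-homo-+; ×1-homo-*) renaming (_×_ to _·_)
  open import Relation.Binary.Reasoning.Setoid setoid

  Σ-map-·1 : ∀ ns → Σ (map (_· 1#) ns) ≈ sum ns · 1#
  Σ-map-·1 []       = refl
  Σ-map-·1 (n ∷ ns) = trans (+-congˡ (Σ-map-·1 ns)) (sym (×-homo-+ 1# n (sum ns)))

  Ψ-map-·1 : ∀ ns → Ψ (map (_· 1#) ns) ≈ Ψℕ ns · 1#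
  Ψ-map-·1 []       = refl
  Ψ-map-·1 (n ∷ ns) = begin
    n · 1# * Σ (map (_· 1#) ns) * (n · 1# + Σ (map (_· 1#) ns)) + Ψ (map (_· 1#) ns)
      ≈⟨ +-cong (*-cong (*-congˡ (Σ-map-·1 ns)) (+-congˡ (Σ-map-·1 ns))) (Ψ-map-·1 ns) ⟩
    n · 1# * (sum ns · 1#) * (n · 1# + sum ns · 1#) + Ψℕ ns · 1#
      ≈⟨ +-congʳ (*-cong (sym (×1-homo-* n (sum ns))) (sym (×-homo-+ 1# n (sum ns)))) ⟩
    (n ℕ.* sum ns) · 1# * (n ℕ.+ sum ns) · 1# + Ψℕ ns · 1#
      ≈⟨ +-congʳ (sym (×1-homo-* (n ℕ.* sum ns) (n ℕ.+ sum ns))) ⟩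
    (n ℕ.* sum ns ℕ.* (n ℕ.+ sum ns)) · 1# + Ψℕ ns · 1#
      ≈⟨ sym (×-homo-+ 1# (n ℕ.* sum ns ℕ.* (n ℕ.+ sum ns)) (Ψℕ ns)) ⟩
    Ψℕ (n ∷ ns) · 1# ∎

module _ {c ℓ} (R : CommutativeRing c ℓ) (h : CommutativeRing.Carrier R) where
  open CommutativeRing R
  open SuffixSums commutativeSemiring
  open import Algebra.Solver.Ring.NaturalCoefficients.Default commutativeSemiring
  open import Relation.Binary.Reasoning.Setoid setoid

  sumR≈Σ : ∀ xs → sumR R xs ≈ Σ xs
  sumR≈Σ []       = refl
  sumR≈Σ (x ∷ xs) = +-congˡ (sumR≈Σ xs)

  -- A prefix p contributes p T₁ T₂, because Σₖ (nₖ + nₖ₊₁) Tₖ₊₁ = T₁ T₂.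
  ΦAcc≈h*Ψ : ∀ p x xs → ΦAcc R h p (x ∷ xs) ≈ h * (Ψ (x ∷ xs) + p * (Σ (x ∷ xs) * Σ xs))
  ΦAcc≈h*Ψ p x [] = solve 3
    (λ h x p → con 0 := h :* (x :* con 0 :* (x :+ con 0) :+ con 0 :+ p :* ((x :+ con 0) :* con 0)))
    refl h x p
  ΦAcc≈h*Ψ p x (y ∷ zs) = begin
    h * ((x + y) * ((p + x) * sumR R (y ∷ zs))) + ΦAcc R h (p + x) (y ∷ zs)
      ≈⟨ +-cong (*-congˡ (*-congˡ (*-congˡ (sumR≈Σ (y ∷ zs))))) (ΦAcc≈h*Ψ (p + x) y zs) ⟩
    h * ((x + y) * ((p + x) * Σ (y ∷ zs))) + h * (Ψ (y ∷ zs) + (p + x) * (Σ (y ∷ zs) * Σ zs))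
      ≈⟨ solve 6 (λ h x y p s t →
           h :* ((x :+ y) :* ((p :+ x) :* (y :+ s))) :+ h :* (t :+ (p :+ x) :* ((y :+ s) :* s))
           := h :* (x :* (y :+ s) :* (x :+ (y :+ s)) :+ t :+ p :* ((x :+ (y :+ s)) :* (y :+ s))))
         refl h x y p (Σ zs) (Ψ (y ∷ zs)) ⟩
    h * (Ψ (x ∷ y ∷ zs) + p * (Σ (x ∷ y ∷ zs) * Σ (y ∷ zs))) ∎

  Φ≈h*Ψ : ∀ xs → Φ R h xs ≈ h * Ψ xs
  Φ≈h*Ψ []       = sym (zeroʳ h)
  Φ≈h*Ψ (x ∷ xs) = trans (ΦAcc≈h*Ψ 0# x xs) (*-congˡ (trans (+-congˡ (zeroˡ _)) (+-identityʳ _)))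

  Φ-↭ : ∀ {xs ys} → xs ↭ ys → Φ R h xs ≈ Φ R h ys
  Φ-↭ {xs} {ys} p = begin
    Φ R h xs ≈⟨ Φ≈h*Ψ xs ⟩
    h * Ψ xs ≈⟨ *-congˡ (Ψ-↭ p) ⟩
    h * Ψ ys ≈⟨ Φ≈h*Ψ ys ⟨
    Φ R h ys ∎

module _ where
  open import Data.Nat using (_+_; _*_)

  m+n≤m*n+1 : ∀ {m n} → 1 ≤ m → 1 ≤ n → m + n ≤ m * n + 1
  m+n≤m*n+1 {suc a} {suc b} _ _ = ℕ.≤-trans (ℕ.m≤m+n _ (a * b)) (ℕ.≤-reflexive (identity a b))
    where
    identity : ∀ a b → suc a + suc b + a * b ≡ suc a * suc b + 1
    identity = solve-∀

  sum-positive : ∀ {x xs} → All (1 ≤_) (x ∷ xs) → 1 ≤ sum (x ∷ xs)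
  sum-positive {x} {xs} (1≤x ∷ _) = ℕ.≤-trans 1≤x (ℕ.m≤m+n x (sum xs))

  sum²≤Ψ+sum : ∀ x y zs → All (1 ≤_) (x ∷ y ∷ zs) →
               sum (x ∷ y ∷ zs) * sum (x ∷ y ∷ zs) ≤ Ψℕ (x ∷ y ∷ zs) + sum (x ∷ y ∷ zs)
  sum²≤Ψ+sum x y [] (1≤x ∷ 1≤y ∷ []) = begin
    (x + s) * (x + s)     ≤⟨ ℕ.*-monoʳ-≤ (x + s) (m+n≤m*n+1 1≤x (sum-positive (1≤y ∷ []))) ⟩
    (x + s) * (x * s + 1) ≡⟨ identity x y ⟩
    Ψℕ (x ∷ y ∷ []) + (x + s) ∎
    where
    open ℕ.≤-Reasoning
    s = sum (y ∷ [])
    identity : ∀ x y → (x + (y + 0)) * (x * (y + 0) + 1)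
                     ≡ x * (y + 0) * (x + (y + 0)) + (y * 0 * (y + 0) + 0) + (x + (y + 0))
    identity = solve-∀
  sum²≤Ψ+sum x y (z ∷ zs) (1≤x ∷ ps) = begin
    (x + s) * (x + s)                   ≡⟨ expand x s ⟩
    x * ((x + s) + s) + s * s           ≤⟨ ℕ.+-mono-≤ (ℕ.*-monoʳ-≤ x (ℕ.+-mono-≤ (m+n≤m*n+1 1≤x 1≤s) s≤s*s))
                                                       (sum²≤Ψ+sum y z zs ps) ⟩
    x * ((x * s + 1) + s * s) + (t + s) ≡⟨ collect x s t ⟩
    x * s * (x + s) + t + (x + s)       ∎
    where
    open ℕ.≤-Reasoning
    s = sum (y ∷ z ∷ zs)
    t = Ψℕ (y ∷ z ∷ zs)
    1≤s = sum-positive ps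
    s≤s*s = ℕ.m≤m*n s s ⦃ >-nonZero 1≤s ⦄
    expand : ∀ x s → (x + s) * (x + s) ≡ x * ((x + s) + s) + s * s
    expand = solve-∀
    collect : ∀ x s t → x * ((x * s + 1) + s * s) + (t + s) ≡ x * s * (x + s) + t + (x + s)
    collect = solve-∀

  n*n≤d+n⇒n*[n∸1]≤d : ∀ n d → n * n ≤ d + n → n * (n ∸ 1) ≤ d
  n*n≤d+n⇒n*[n∸1]≤d zero    d _  = z≤n
  n*n≤d+n⇒n*[n∸1]≤d (suc k) d le = ℕ.+-cancelʳ-≤ (suc k) _ _ (ℕ.≤-trans (ℕ.≤-reflexive (identity k)) le)
    where
    identity : ∀ k → suc k * k + suc k ≡ suc k * suc k
    identity = solve-∀

  sum*[sum∸1]≤Ψ : ∀ {ns} → All (1 ≤_) ns → 2 ≤ length ns → sum ns * (sum ns ∸ 1) ≤ Ψℕ ns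
  sum*[sum∸1]≤Ψ {x ∷ y ∷ zs} ps (s≤s (s≤s z≤n)) = n*n≤d+n⇒n*[n∸1]≤d _ _ (sum²≤Ψ+sum x y zs ps)

private
  module ℚ-ring = CommutativeRing ℚ.+-*-commutativeRing

open import Algebra.Properties.Semiring.Mult ℚ-ring.semiring using (×1-homo-*) renaming (_×_ to _·_)

ℕ→ℚ≡mkℚ : ∀ k → ℕ→ℚ k ≡ mkℚ (+ k) 0 (coprime-sym (1-coprimeTo k))
ℕ→ℚ≡mkℚ k = ℚ.normalize-coprime (coprime-sym (1-coprimeTo k))

ℕ→ℚ-suc : ∀ k → ℕ→ℚ (suc k) ≡ 1ℚ +ℚ ℕ→ℚ k
ℕ→ℚ-suc k = ≡.sym (≡.trans (cong (1ℚ +ℚ_) (ℕ→ℚ≡mkℚ k))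
                           (cong (λ i → (+ 1 ℤ.+ i) Data.Rational./ 1) (ℤ.*-identityʳ (+ k))))

ℕ→ℚ≡·1 : ∀ k → ℕ→ℚ k ≡ k · 1ℚ
ℕ→ℚ≡·1 zero    = ≡.refl
ℕ→ℚ≡·1 (suc k) = ≡.trans (ℕ→ℚ-suc k) (cong (1ℚ +ℚ_) (ℕ→ℚ≡·1 k))

ℕ→ℚ-homo-* : ∀ m n → ℕ→ℚ (m ℕ.* n) ≡ ℕ→ℚ m *ℚ ℕ→ℚ n
ℕ→ℚ-homo-* m n rewrite ℕ→ℚ≡·1 (m ℕ.* n) | ℕ→ℚ≡·1 m | ℕ→ℚ≡·1 n = ×1-homo-* m n

ℕ→ℚ-mono-≤ : ∀ {m n} → m ≤ n → ℕ→ℚ m ≤ℚ ℕ→ℚ n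
ℕ→ℚ-mono-≤ {m} {n} m≤n rewrite ℕ→ℚ≡mkℚ m | ℕ→ℚ≡mkℚ n = *≤* (ℤ.*-monoʳ-≤-nonNeg (+ 1) (ℤ.+≤+ m≤n))

Φℚ-map : ∀ ns → Φℚ (map ℕ→ℚ ns) ≡ ℕ→ℚ (Ψℕ ns) *ℚ ½
Φℚ-map ns = begin
  Φℚ (map ℕ→ℚ ns)               ≡⟨ Φ≈h*Ψ ℚ.+-*-commutativeRing ½ (map ℕ→ℚ ns) ⟩
  ½ *ℚ Ψℚ (map ℕ→ℚ ns)          ≡⟨ cong (λ xs → ½ *ℚ Ψℚ xs) (map-cong ℕ→ℚ≡·1 ns) ⟩
  ½ *ℚ Ψℚ (map (_· 1ℚ) ns)      ≡⟨ cong (½ *ℚ_) (Ψ-map-·1 ℚ-ring.commutativeSemiring ns) ⟩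
  ½ *ℚ (Ψℕ ns · 1ℚ)             ≡⟨ cong (½ *ℚ_) (ℕ→ℚ≡·1 (Ψℕ ns)) ⟨
  ½ *ℚ ℕ→ℚ (Ψℕ ns)              ≡⟨ ℚ.*-comm ½ (ℕ→ℚ (Ψℕ ns)) ⟩
  ℕ→ℚ (Ψℕ ns) *ℚ ½              ∎
  where
  open ≡.≡-Reasoning
  open SuffixSums ℚ-ring.commutativeSemiring using () renaming (Ψ to Ψℚ)

Φℚ-swap : ∀ p q → Φℚ (p ∷ q ∷ []) ≡ Φℚ (q ∷ p ∷ [])
Φℚ-swap p q = Φ-↭ ℚ.+-*-commutativeRing ½ {p ∷ q ∷ []} {q ∷ p ∷ []} (↭-swap p q ↭-refl)

Φℚ-1∷≡ℕ→ℚ : ∀ {n} → 1 ≤ n → Φℚ (ℕ→ℚ 1 ∷ ℕ→ℚ (n ∸ 1) ∷ []) ≡ ℕ→ℚ (n ℕ.* (n ∸ 1)) *ℚ ½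
Φℚ-1∷≡ℕ→ℚ {n} 1≤n = ≡.trans (Φℚ-map (1 ∷ n ∸ 1 ∷ []))
  (cong (λ k → ℕ→ℚ k *ℚ ½) (≡.trans (Ψℕ-1∷ (n ∸ 1)) (cong (ℕ._* (n ∸ 1)) (ℕ.m+[n∸m]≡n 1≤n))))
  where
  open import Data.Nat using (_+_; _*_)
  -- solve-∀ only reads the unfolded form of Ψℕ (1 ∷ k ∷ []).
  identity : ∀ k → 1 * (k + 0) * (1 + (k + 0)) + (k * 0 * (k + 0) + 0) ≡ suc k * k
  identity = solve-∀
  Ψℕ-1∷ : ∀ k → Ψℕ (1 ∷ k ∷ []) ≡ suc k * k
  Ψℕ-1∷ = identity

Φℚ-1∷≡ : ∀ n → 1 ≤ n → Φℚ (ℕ→ℚ 1 ∷ ℕ→ℚ (n ∸ 1) ∷ []) ≡ (ℕ→ℚ n *ℚ ℕ→ℚ (n ∸ 1)) *ℚ ½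
Φℚ-1∷≡ n 1≤n = ≡.trans (Φℚ-1∷≡ℕ→ℚ 1≤n) (cong (_*ℚ ½) (ℕ→ℚ-homo-* n (n ∸ 1)))

Φℚ-partition-bound : ∀ {n} P → All (1 ≤_) P → sum P ≡ n → 2 ≤ length P →
                     Φℚ (ℕ→ℚ (n ∸ 1) ∷ ℕ→ℚ 1 ∷ []) ≤ℚ Φℚ (map ℕ→ℚ P)
Φℚ-partition-bound P@(_ ∷ _) ps ≡.refl 2≤|P| = begin
  Φℚ (ℕ→ℚ (n ∸ 1) ∷ ℕ→ℚ 1 ∷ [])  ≡⟨ Φℚ-swap (ℕ→ℚ (n ∸ 1)) (ℕ→ℚ 1) ⟩
  Φℚ (ℕ→ℚ 1 ∷ ℕ→ℚ (n ∸ 1) ∷ [])  ≡⟨ Φℚ-1∷≡ℕ→ℚ (sum-positive ps) ⟩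
  ℕ→ℚ (n ℕ.* (n ∸ 1)) *ℚ ½       ≤⟨ ℚ.*-monoʳ-≤-nonNeg ½ (ℕ→ℚ-mono-≤ (sum*[sum∸1]≤Ψ ps 2≤|P|)) ⟩
  ℕ→ℚ (Ψℕ P) *ℚ ½                ≡⟨ Φℚ-map P ⟨
  Φℚ (map ℕ→ℚ P)                 ∎
  where
  open ℚ.≤-Reasoning
  n = sum P

lemmaA0p11 : ∀ {c ℓ : Level} →
    (∀ (R : CommutativeRing c ℓ) (h : CommutativeRing.Carrier R) →
       CommutativeRing._≈_ R (CommutativeRing._+_ R h h) (CommutativeRing.1# R) →
       ∀ (r : ℕ) (x : Fin r → CommutativeRing.Carrier R) (σ : Permutation′ r) →
       CommutativeRing._≈_ R (Φ R h (tabulate x)) (Φ R h (tabulate (λ i → x (σ ⟨$⟩ʳ i)))))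
    ×
    (∀ (n : ℕ) → 1 ≤ n →
       (Φℚ (ℕ→ℚ (n ∸ 1) ∷ ℕ→ℚ 1 ∷ []) ≡ Φℚ (ℕ→ℚ 1 ∷ ℕ→ℚ (n ∸ 1) ∷ []))
       ×
       (Φℚ (ℕ→ℚ 1 ∷ ℕ→ℚ (n ∸ 1) ∷ []) ≡ (ℕ→ℚ n *ℚ ℕ→ℚ (n ∸ 1)) *ℚ ½)
       ×
       (∀ (P : List ℕ) → All (1 ≤_) P → sum P ≡ n → 2 ≤ length P →
          Φℚ (ℕ→ℚ (n ∸ 1) ∷ ℕ→ℚ 1 ∷ []) ≤ℚ Φℚ (map ℕ→ℚ P)))
lemmaA0p11 =
  (λ R h _ r x σ → Φ-↭ R h (tabulate-↭ x σ)) ,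
  λ n 1≤n → Φℚ-swap (ℕ→ℚ (n ∸ 1)) (ℕ→ℚ 1) , Φℚ-1∷≡ n 1≤n , Φℚ-partition-bound
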